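{- For any positive integers $a,b,c$, $\mathrm{def}_c(S_{a,b,c})=\mathrm{def}_c(M_{a,b,c})=0$; that is, both $S_{a,b,c}$ and $M_{a,b,c}$ admit cyclic interval colorings.
   Context: All graphs are finite, simple and undirected. A proper $t$-edge coloring of $G$ is a map $\alpha:E(G)\to\{1,\dots,t\}$ giving adjacent edges distinct colors; $S(v,\alpha)$ is the set of colors on edges incident to $v$. A set $A\subseteq\{1,\dots,t\}$ is a cyclic interval modulo $t$ if $A$ or $\{1,\dots,t\}\setminus A$ is an interval of integers. A cyclic interval $t$-coloring is a proper $t$-edge coloring in which $S(v,\alpha)$ is a cyclic interval modulo $t$ for every vertex $v$. The deficiency modulo $t$ of a set $A$ of positive integers is the minimum size of a set $B$ of positive integers such that $A\cup B$ is a cyclic interval modulo $t$. For a proper $t$-edge coloring $\alpha$ of $G$, $\mathrm{def}_c(v,\alpha)$ is the deficiency modulo $t$ of $S(v,\alpha)$, $\mathrm{def}_c(G,\alpha)=\sum_{v}\mathrm{def}_c(v,\alpha)$, and the cyclic deficiency $\mathrm{def}_c(G)$ is the minimum of $\mathrm{def}_c(G,\alpha)$ over all proper edge colorings $\alpha$ of $G$ (with any number $t$ of colors); equivalently, it is the minimum number of pendant edges whose attachment to $G$ yields a graph with a cyclic interval coloring. $S_{a,b,c}$ has vertex set $\{u_0,u_1,u_2,u_3,v_1,v_2,v_3\}\cup\{x_1,\dots,x_a,y_1,\dots,y_b,z_1,\dots,z_c\}$ and edge set $\{u_1v_1,v_1u_2,u_2v_2,v_2u_3,u_3v_3,v_3u_1\}\cup\{u_0x_i,u_1x_i:1\le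 i\le a\}\cup\{u_0y_j,u_2y_j:1\le j\le b\}\cup\{u_0z_k,u_3z_k:1\le k\le c\}$. $M_{a,b,c}$ has vertex set $\{u_0,u_1,u_2,u_3\}\cup\{x_1,\dots,x_a,y_1,\dots,y_b,z_1,\dots,z_c\}$ and edge set $\{u_0x_i,u_1x_i,u_2x_i:1\le i\le a\}\cup\{u_0y_j,u_2y_j,u_3y_j:1\le j\le b\}\cup\{u_0z_k,u_3z_k,u_1z_k:1\le k\le c\}$. -}

module Defs where

open import Data.Nat using (ℕ; zero; suc; _+_; _≤_; _<_)
open import Data.Fin using (Fin)
open import Data.List using (List; []; _∷_; _++_; length; lookup; upTo; concatMap)
open import Data.Product using (_×_; _,_; Σ; ∃; ∃-syntax; proj₁; proj₂)
open import Data.Sum using (_⊎_)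
open import Relation.Nullary using (¬_)
open import Relation.Binary.PropositionalEquality using (_≡_; _≢_)
open import Function.Bundles using (_⇔_)

-- A finite simple graph: vertices are 0 … n-1, edges are listed as pairs.
record Graph : Set where
  constructor mkGraph
  field
    n     : ℕ
    edges : List (ℕ × ℕ)
open Graph public

Edge : Graph → Set
Edge G = Fin (length (edges G))

endpoints : (G : Graph) → Edge G → ℕ × ℕ
endpoints G e = lookup (edges G) e

Incident : (G : Graph) → ℕ → Edge G → Set
Incident G v e = (v ≡ proj₁ (endpoints G e)) ⊎ (v ≡ proj₂ (endpoints G e))

IsProperColoring : (G : Graph) → ℕ → (Edge G → ℕ) → Set
IsProperColoring G t α =
  ((e : Edge G) → (1 ≤ α e) × (α e ≤ t)) ×
  ((e e' : Edge G) → e ≢ e' → (v : ℕ) → Incident G v e → Incident G v e' → α e ≢ α e')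

InS : (G : Graph) → (Edge G → ℕ) → ℕ → ℕ → Set
InS G α v c = ∃[ e ] (Incident G v e × (α e ≡ c))

IsInterval : (ℕ → Set) → Set
IsInterval A = ∃[ lo ] ∃[ hi ] ((c : ℕ) → A c ⇔ ((lo ≤ c) × (c ≤ hi)))

Compl : ℕ → (ℕ → Set) → ℕ → Set
Compl t A c = (1 ≤ c) × (c ≤ t) × ¬ A c

IsCyclicInterval : ℕ → (ℕ → Set) → Set
IsCyclicInterval t A = IsInterval A ⊎ IsInterval (Compl t A)

IsCyclicIntervalColoring : (G : Graph) → ℕ → (Edge G → ℕ) → Set
IsCyclicIntervalColoring G t α =
  IsProperColoring G t α × ((v : ℕ) → v < n G → IsCyclicInterval t (InS G α v))

HasCyclicIntervalColoring : Graph → Set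
HasCyclicIntervalColoring G = ∃[ t ] Σ (Edge G → ℕ) (IsCyclicIntervalColoring G t)

-- Vertex numbering for S_{a,b,c}:
--   u0=0, u1=1, u2=2, u3=3, v1=4, v2=5, v3=6,
--   x_i = 6+i (1≤i≤a), y_j = 6+a+j (1≤j≤b), z_k = 6+a+b+k (1≤k≤c).
-- (upTo m = 0 … m-1, so index i ranges over 0 … a-1 and x_{i+1} = 7+i.)
S-graph : ℕ → ℕ → ℕ → Graph
S-graph a b c = mkGraph (7 + a + b + c)
  ( ((1 , 4) ∷ (4 , 2) ∷ (2 , 5) ∷ (5 , 3) ∷ (3 , 6) ∷ (6 , 1) ∷ [])
  ++ concatMap (λ i → (0 , 7 + i) ∷ (1 , 7 + i) ∷ []) (upTo a)
  ++ concatMap (λ j → (0 , 7 + a + j) ∷ (2 , 7 + a + j) ∷ []) (upTo b)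
  ++ concatMap (λ k → (0 , 7 + a + b + k) ∷ (3 , 7 + a + b + k) ∷ []) (upTo c) )

-- Vertex numbering for M_{a,b,c}:
--   u0=0, u1=1, u2=2, u3=3, x_i = 3+i, y_j = 3+a+j, z_k = 3+a+b+k.
M-graph : ℕ → ℕ → ℕ → Graph
M-graph a b c = mkGraph (4 + a + b + c)
  ( concatMap (λ i → (0 , 4 + i) ∷ (1 , 4 + i) ∷ (2 , 4 + i) ∷ []) (upTo a)
  ++ concatMap (λ j → (0 , 4 + a + j) ∷ (2 , 4 + a + j) ∷ (3 , 4 + a + j) ∷ []) (upTo b)
  ++ concatMap (λ k → (0 , 4 + a + b + k) ∷ (3 , 4 + a + b + k) ∷ (1 , 4 + a + b + k) ∷ []) (upTo c) )

-- Both graphs are coloured with t = N + 2 colours, N = a + b + c, after numbering the common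
-- neighbours of u₀ as leaves 0, …, N-1.  In S, leaf m gets colour m+1 towards u₀ and m+2 towards
-- its other neighbour, and the hexagon u₁v₁u₂v₂u₃v₃ gets a+2, a+1, a+b+2, a+b+1, N+2, 1; so u₁, u₂,
-- u₃ see [1, a+2], [a+1, a+b+2], [a+b+1, N+2], and v₃ sees {N+2, 1}, which is cyclic.  In M, leaf m
-- sees m+1, m+2, m+3 with m+2 towards u₀, and its other two edges are chosen so that u₂ and u₃ see
-- [3, a+b+2] and [a+1, N] while u₁ sees [1, a] ∪ [a+b+3, N+2], again cyclic.
-- Each colouring is verified through a decoder returning, at every vertex, the edge of a given
-- colour: this gives properness, and the colour set of the vertex is exactly the arc on which the
-- decoder is shown to hit an incident edge.

module Submission where

open import Defs
open import Data.Nat using (ℕ; zero; suc; _+_; _∸_; _≤_; _<_; z≤n; s≤s; _≡ᵇ_; _<ᵇ_; _<?_)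
open import Data.Nat.Properties
open import Data.Bool using (if_then_else_)
open import Data.Product using (_×_; _,_; ∃-syntax; proj₁; proj₂)
open import Data.Product.Properties using (≡-dec)
open import Data.Sum using (_⊎_; inj₁; inj₂; [_,_])
open import Data.Fin using () renaming (zero to fzero; suc to fsuc)
open import Data.List using (List; []; _∷_; _++_; map; lookup; upTo; concatMap)
open import Data.List.Membership.Propositional using (_∈_; find; lose)
open import Data.List.Membership.Propositional.Properties
  using (∈-lookup; ∈-++⁺ˡ; ∈-++⁺ʳ; ∈-++⁻; ∈-map⁺; ∈-map⁻; ∈-concatMap⁺; ∈-concatMap⁻; ∈-upTo⁺; ∈-upTo⁻)
open import Data.List.Relation.Unary.Any using (here; there; index)
open import Data.List.Relation.Unary.Any.Properties using (lookup-index)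
open import Data.List.Relation.Unary.All as All using (All; all?)
import Data.List.Relation.Unary.All.Properties as All
open import Data.List.Relation.Unary.Unique.Propositional using (Unique; []; _∷_)
import Data.List.Relation.Unary.Unique.Propositional.Properties as Unique
open import Data.List.Relation.Unary.Unique.DecPropositional (≡-dec _≟_ _≟_) using (unique?)
import Data.List.Relation.Unary.Unique.DecPropositional _≟_ as Uniqueℕ
open import Relation.Nullary using (contradiction)
open import Relation.Nullary.Decidable using (from-yes; yes; no)
open import Relation.Binary.PropositionalEquality using (_≡_; _≢_; refl; sym; trans; cong; subst; module ≡-Reasoning)
open import Function using (_∘_)
open import Function.Bundles using (_⇔_; mk⇔; Equivalence)

ifEq : {A : Set} → ℕ → ℕ → A → A → A
ifEq m n p q = if m ≡ᵇ n then p else q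

ifEq-≡ : ∀ {A : Set} m {p q : A} → ifEq m m p q ≡ p
ifEq-≡ zero    = refl
ifEq-≡ (suc m) = ifEq-≡ m

ifEq-≢ : ∀ {A : Set} {m n} {p q : A} → m ≢ n → ifEq m n p q ≡ q
ifEq-≢ {m = zero}  {zero}  m≢n = contradiction refl m≢n
ifEq-≢ {m = zero}  {suc n} _   = refl
ifEq-≢ {m = suc m} {zero}  _   = refl
ifEq-≢ {m = suc m} {suc n} m≢n = ifEq-≢ (m≢n ∘ cong suc)

ifLt : {A : Set} → ℕ → ℕ → A → A → A
ifLt m n p q = if m <ᵇ n then p else q

ifLt-< : ∀ {A : Set} {m n} {p q : A} → m < n → ifLt m n p q ≡ p
ifLt-< {m = zero}  (s≤s _)   = refl
ifLt-< {m = suc m} (s≤s m<n) = ifLt-< m<n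

ifLt-≥ : ∀ {A : Set} {m n} {p q : A} → n ≤ m → ifLt m n p q ≡ q
ifLt-≥ z≤n       = refl
ifLt-≥ (s≤s n≤m) = ifLt-≥ n≤m

data Arc (t : ℕ) : Set where
  inside  : (lo hi : ℕ) → Arc t
  outside : (lo hi : ℕ) → 1 ≤ lo → hi ≤ t → Arc t

infix 4 _∈ᵃ_
_∈ᵃ_ : ∀ {t} → ℕ → Arc t → Set
x ∈ᵃ inside lo hi        = lo ≤ x × x ≤ hi
_∈ᵃ_ {t} x (outside lo hi _ _) = (1 ≤ x × x < lo) ⊎ (hi < x × x ≤ t)

arc-cyclic : ∀ {t} {P : ℕ → Set} (A : Arc t) → (∀ x → P x ⇔ x ∈ᵃ A) → IsCyclicInterval t P
arc-cyclic (inside lo hi) P⇔A = inj₁ (lo , hi , P⇔A)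
arc-cyclic {t} {P} (outside lo hi 1≤lo hi≤t) P⇔A = inj₂ (lo , hi , λ x → mk⇔ to from)
  where
  to : ∀ {x} → Compl t P x → lo ≤ x × x ≤ hi
  to {x} (1≤x , x≤t , ¬Px) =
      ≮⇒≥ (λ x<lo → ¬Px (Equivalence.from (P⇔A x) (inj₁ (1≤x , x<lo))))
    , ≮⇒≥ (λ hi<x → ¬Px (Equivalence.from (P⇔A x) (inj₂ (hi<x , x≤t))))
  from : ∀ {x} → lo ≤ x × x ≤ hi → Compl t P x
  from {x} (lo≤x , x≤hi) =
      ≤-trans 1≤lo lo≤x , ≤-trans x≤hi hi≤t
    , λ Px → [ (λ (_ , x<lo) → <⇒≱ x<lo lo≤x) , (λ (hi<x , _) → <⇒≱ hi<x x≤hi) ]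
                (Equivalence.to (P⇔A x) Px)

data IntervalView (lo hi : ℕ) : ℕ → Set where
  lower : IntervalView lo hi lo
  upper : IntervalView lo hi hi
  inner : ∀ k → suc lo + k < hi → IntervalView lo hi (suc lo + k)

interval-view : ∀ {lo hi x} → lo ≤ x → x ≤ hi → IntervalView lo hi x
interval-view lo≤x x≤hi with m≤n⇒m<n∨m≡n lo≤x
... | inj₂ refl = lower
... | inj₁ lo<x with m≤n⇒m<n∨m≡n x≤hi
...   | inj₂ refl = upper
...   | inj₁ x<hi with m≤n⇒∃[o]m+o≡n lo<x
...     | k , refl = inner k x<hi

lookup-injective : ∀ {A : Set} {xs : List A} → Unique xs → ∀ i j → lookup xs i ≡ lookup xs j → i ≡ j
lookup-injective (_ ∷ _)        fzero    fzero    _  = refl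
lookup-injective (x∉xs ∷ _)      fzero    (fsuc j) eq = contradiction eq (All.lookup x∉xs (∈-lookup j))
lookup-injective (x∉xs ∷ _)      (fsuc i) fzero    eq = contradiction (sym eq) (All.lookup x∉xs (∈-lookup i))
lookup-injective (_ ∷ xs-unique) (fsuc i) (fsuc j) eq = cong fsuc (lookup-injective xs-unique i j eq)

concatMap-unique : ∀ {A B : Set} {f : A → List B} {xs} → Unique xs → (∀ x → Unique (f x)) →
                   (∀ {x y z} → z ∈ f x → z ∈ f y → x ≡ y) → Unique (concatMap f xs)
concatMap-unique {xs = []}     _                  _        _         = []
concatMap-unique {f = f} {xs = x ∷ xs} (x∉xs ∷ xs-unique) f-unique separated =
  Unique.++⁺ (f-unique x) (concatMap-unique xs-unique f-unique separated) λ (z∈fx , z∈rest) →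
    let y , y∈xs , z∈fy = find (∈-concatMap⁻ f {xs = xs} z∈rest)
    in All.lookup x∉xs y∈xs (separated z∈fx z∈fy)

biclique : List ℕ → ℕ → ℕ → List (ℕ × ℕ)
biclique hubs s n = concatMap (λ i → map (λ u → (u , s + i)) hubs) (upTo n)

∈-biclique⁺ : ∀ {hubs s n u i} → u ∈ hubs → i < n → (u , s + i) ∈ biclique hubs s n
∈-biclique⁺ {hubs} {s} u∈hubs i<n =
  ∈-concatMap⁺ (λ i → map (λ u → (u , s + i)) hubs) (lose (∈-upTo⁺ i<n) (∈-map⁺ (λ u → (u , s + _)) u∈hubs))

∈-biclique⁻ : ∀ hubs s n {p} → p ∈ biclique hubs s n → ∃[ u ] ∃[ i ] (u ∈ hubs × i < n × p ≡ (u , s + i))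
∈-biclique⁻ hubs s n p∈biclique with find (∈-concatMap⁻ (λ i → map (λ u → (u , s + i)) hubs) {xs = upTo n} p∈biclique)
... | i , i∈upTo , p∈map with ∈-map⁻ (λ u → (u , s + i)) p∈map
...   | u , u∈hubs , eq = u , i , u∈hubs , ∈-upTo⁻ i∈upTo , eq

biclique-unique : ∀ hubs s n → Unique hubs → Unique (biclique hubs s n)
biclique-unique hubs s n hubs-unique =
  concatMap-unique (Unique.upTo⁺ n) (λ _ → Unique.map⁺ (cong proj₁) hubs-unique) same-leaf
  where
  same-leaf : ∀ {i j p} → p ∈ map (λ u → (u , s + i)) hubs → p ∈ map (λ u → (u , s + j)) hubs → i ≡ j
  same-leaf {i} {j} p∈i p∈j with ∈-map⁻ (λ u → (u , s + i)) p∈i | ∈-map⁻ (λ u → (u , s + j)) p∈j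
  ... | _ , _ , refl | _ , _ , eq = +-cancelˡ-≡ s i j (cong proj₂ eq)

biclique-above : ∀ hubs s n {k} → k ≤ s → All ((k ≤_) ∘ proj₂) (biclique hubs s n)
biclique-above hubs s n {k} k≤s = All.tabulate above
  where
  above : ∀ {p} → p ∈ biclique hubs s n → k ≤ proj₂ p
  above p∈biclique with ∈-biclique⁻ hubs s n p∈biclique
  ... | _ , i , _ , _ , refl = ≤-trans k≤s (m≤m+n s i)

biclique-below : ∀ hubs s n → All ((_< s + n) ∘ proj₂) (biclique hubs s n)
biclique-below hubs s n = All.tabulate below
  where
  below : ∀ {p} → p ∈ biclique hubs s n → proj₂ p < s + n
  below p∈biclique with ∈-biclique⁻ hubs s n p∈biclique
  ... | _ , _ , _ , i<n , refl = +-monoʳ-< s i<n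

++-unique-separated : ∀ {xs ys : List (ℕ × ℕ)} k → Unique xs → Unique ys →
  All ((_< k) ∘ proj₂) xs → All ((k ≤_) ∘ proj₂) ys → Unique (xs ++ ys)
++-unique-separated k xs-unique ys-unique xs<k k≤ys =
  Unique.++⁺ xs-unique ys-unique λ (p∈xs , p∈ys) → <⇒≱ (All.lookup xs<k p∈xs) (All.lookup k≤ys p∈ys)

bicliques : (h₁ h₂ h₃ : List ℕ) (s a b c : ℕ) → List (ℕ × ℕ)
bicliques h₁ h₂ h₃ s a b c = biclique h₁ s a ++ biclique h₂ (s + a) b ++ biclique h₃ (s + a + b) c

bicliques-unique : ∀ {h₁ h₂ h₃} s a b c → Unique h₁ → Unique h₂ → Unique h₃ → Unique (bicliques h₁ h₂ h₃ s a b c)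
bicliques-unique {h₁} {h₂} {h₃} s a b c h₁-unique h₂-unique h₃-unique =
  ++-unique-separated (s + a) (biclique-unique h₁ s a h₁-unique)
    (++-unique-separated (s + a + b) (biclique-unique h₂ (s + a) b h₂-unique) (biclique-unique h₃ (s + a + b) c h₃-unique)
      (biclique-below h₂ (s + a) b) (biclique-above h₃ (s + a + b) c ≤-refl))
    (biclique-below h₁ s a)
    (All.++⁺ (biclique-above h₂ (s + a) b ≤-refl) (biclique-above h₃ (s + a + b) c (m≤m+n (s + a) b)))

bicliques-above : ∀ h₁ h₂ h₃ s a b c → All ((s ≤_) ∘ proj₂) (bicliques h₁ h₂ h₃ s a b c)
bicliques-above h₁ h₂ h₃ s a b c =
  All.++⁺ (biclique-above h₁ s a ≤-refl)
    (All.++⁺ (biclique-above h₂ (s + a) b (m≤m+n s a)) (biclique-above h₃ (s + a + b) c (≤-trans (m≤m+n s a) (m≤m+n (s + a) b))))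

IsEndpoint : ℕ → ℕ × ℕ → Set
IsEndpoint v p = (v ≡ proj₁ p) ⊎ (v ≡ proj₂ p)

module _ {t : ℕ} (G : Graph) (colour : ℕ × ℕ → ℕ) (palette : ℕ → Arc t) (edgeAt : ℕ → ℕ → ℕ × ℕ) where

  Decodes : ℕ → ℕ × ℕ → Set
  Decodes v p = colour p ∈ᵃ palette v × edgeAt v (colour p) ≡ p

  Realises : ℕ → ℕ → Set
  Realises v x = edgeAt v x ∈ edges G × IsEndpoint v (edgeAt v x) × colour (edgeAt v x) ≡ x

record Certificate (G : Graph) (t : ℕ) : Set where
  field
    colour  : ℕ × ℕ → ℕ
    palette : ℕ → Arc t
    edgeAt  : ℕ → ℕ → ℕ × ℕ
    edges-unique : Unique (edges G)
    colour-bounded : ∀ {p} → p ∈ edges G → 1 ≤ colour p × colour p ≤ t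
    decodes  : ∀ {v p} → p ∈ edges G → IsEndpoint v p → Decodes G colour palette edgeAt v p
    realises : ∀ {v x} → v < n G → x ∈ᵃ palette v → Realises G colour palette edgeAt v x

certified⇒cyclic-interval-colourable : ∀ {G t} → Certificate G t → HasCyclicIntervalColoring G
certified⇒cyclic-interval-colourable {G} {t} cert = t , α , (bounded , proper) , cyclic
  where
  open Certificate cert

  α : Edge G → ℕ
  α e = colour (endpoints G e)

  bounded : ∀ e → 1 ≤ α e × α e ≤ t
  bounded e = colour-bounded (∈-lookup e)

  proper : ∀ e e' → e ≢ e' → ∀ v → Incident G v e → Incident G v e' → α e ≢ α e'
  proper e e' e≢e' v v∈e v∈e' αe≡αe' = e≢e' (lookup-injective edges-unique e e' (begin
    endpoints G e              ≡⟨ proj₂ (decodes (∈-lookup e) v∈e) ⟨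
    edgeAt v (α e)             ≡⟨ cong (edgeAt v) αe≡αe' ⟩
    edgeAt v (α e')            ≡⟨ proj₂ (decodes (∈-lookup e') v∈e') ⟩
    endpoints G e'             ∎))
    where open ≡-Reasoning

  InS⇔palette : ∀ {v} → v < n G → ∀ x → InS G α v x ⇔ x ∈ᵃ palette v
  InS⇔palette {v} v<n x = mk⇔ to from
    where
    to : InS G α v x → x ∈ᵃ palette v
    to (e , v∈e , refl) = proj₁ (decodes (∈-lookup e) v∈e)
    from : x ∈ᵃ palette v → InS G α v x
    from x∈palette with realises v<n x∈palette
    ... | p∈edges , v∈p , colour≡x = index p∈edges , subst (IsEndpoint v) p≡e v∈p , trans (cong colour (sym p≡e)) colour≡x
      where p≡e = lookup-index p∈edges

  cyclic : ∀ v → v < n G → IsCyclicInterval t (InS G α v)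
  cyclic v v<n = arc-cyclic (palette v) (InS⇔palette v<n)

-- The common neighbours x_1 … x_a, y_1 … y_b, z_1 … z_c of u₀ are numbered 0 … N-1
-- in this order.
module Leaves (a b c : ℕ) where

  N : ℕ
  N = a + b + c

  data Leaf : ℕ → Set where
    x-leaf : ∀ {i} → i < a → Leaf i
    y-leaf : ∀ {j} → j < b → Leaf (a + j)
    z-leaf : ∀ {k} → k < c → Leaf (a + b + k)

  leaf : ∀ {m} → m < N → Leaf m
  leaf {m} m<N with m <? a | m <? a + b
  ... | yes m<a | _ = x-leaf m<a
  ... | no m≮a | yes m<a+b with j , refl ← m≤n⇒∃[o]m+o≡n (≮⇒≥ m≮a) = y-leaf (+-cancelˡ-< a _ _ m<a+b)
  ... | no _ | no m≮a+b with k , refl ← m≤n⇒∃[o]m+o≡n (≮⇒≥ m≮a+b) = z-leaf (+-cancelˡ-< (a + b) _ _ m<N)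

  a+b≤N : a + b ≤ N
  a+b≤N = m≤m+n (a + b) c

  a≤N : a ≤ N
  a≤N = ≤-trans (m≤m+n a b) a+b≤N

  x<N : ∀ {i} → i < a → i < N
  x<N i<a = ≤-trans i<a a≤N

  y<N : ∀ {j} → j < b → a + j < N
  y<N j<b = ≤-trans (+-monoʳ-< a j<b) (m≤m+n (a + b) c)

  z<N : ∀ {k} → k < c → a + b + k < N
  z<N = +-monoʳ-< (a + b)

module S-certificate (a b c : ℕ) where
  open Leaves a b c

  G : Graph
  G = S-graph a b c

  data SEdge : ℕ × ℕ → Set where
    u₁v₁ : SEdge (1 , 4)
    v₁u₂ : SEdge (4 , 2)
    u₂v₂ : SEdge (2 , 5)
    v₂u₃ : SEdge (5 , 3)
    u₃v₃ : SEdge (3 , 6)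
    v₃u₁ : SEdge (6 , 1)
    u₀-leaf : ∀ {m} → m < N → SEdge (0 , 7 + m)
    x-u₁ : ∀ {i} → i < a → SEdge (1 , 7 + i)
    y-u₂ : ∀ {j} → j < b → SEdge (2 , 7 + (a + j))
    z-u₃ : ∀ {k} → k < c → SEdge (3 , 7 + (a + b + k))

  hexagon : List (ℕ × ℕ)
  hexagon = (1 , 4) ∷ (4 , 2) ∷ (2 , 5) ∷ (5 , 3) ∷ (3 , 6) ∷ (6 , 1) ∷ []

  x-edges y-edges z-edges : List (ℕ × ℕ)
  x-edges = biclique (0 ∷ 1 ∷ []) 7 a
  y-edges = biclique (0 ∷ 2 ∷ []) (7 + a) b
  z-edges = biclique (0 ∷ 3 ∷ []) (7 + a + b) c

  ∈-edges⁻ : ∀ {p} → p ∈ edges G → SEdge p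
  ∈-edges⁻ p∈edges with ∈-++⁻ hexagon p∈edges
  ... | inj₁ (here refl)                                           = u₁v₁
  ... | inj₁ (there (here refl))                                   = v₁u₂
  ... | inj₁ (there (there (here refl)))                           = u₂v₂
  ... | inj₁ (there (there (there (here refl))))                   = v₂u₃
  ... | inj₁ (there (there (there (there (here refl)))))           = u₃v₃
  ... | inj₁ (there (there (there (there (there (here refl)))))) = v₃u₁
  ... | inj₂ p∈leaves with ∈-++⁻ x-edges p∈leaves
  ...   | inj₁ p∈x with ∈-biclique⁻ (0 ∷ 1 ∷ []) 7 a p∈x
  ...     | _ , _ , here refl         , i<a , refl = u₀-leaf (x<N i<a)
  ...     | _ , _ , there (here refl) , i<a , refl = x-u₁ i<a
  ∈-edges⁻ _ | inj₂ _ | inj₂ p∈yz with ∈-++⁻ y-edges p∈yz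
  ...   | inj₁ p∈y with ∈-biclique⁻ (0 ∷ 2 ∷ []) (7 + a) b p∈y
  ...     | _ , _ , here refl         , j<b , refl = u₀-leaf (y<N j<b)
  ...     | _ , _ , there (here refl) , j<b , refl = y-u₂ j<b
  ∈-edges⁻ _ | inj₂ _ | inj₂ _ | inj₂ p∈z with ∈-biclique⁻ (0 ∷ 3 ∷ []) (7 + a + b) c p∈z
  ...     | _ , _ , here refl         , k<c , refl = u₀-leaf (z<N k<c)
  ...     | _ , _ , there (here refl) , k<c , refl = z-u₃ k<c

  in-x : ∀ {p} → p ∈ x-edges → p ∈ edges G
  in-x = ∈-++⁺ʳ hexagon ∘ ∈-++⁺ˡ
  in-y : ∀ {p} → p ∈ y-edges → p ∈ edges G
  in-y = ∈-++⁺ʳ hexagon ∘ ∈-++⁺ʳ x-edges ∘ ∈-++⁺ˡ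
  in-z : ∀ {p} → p ∈ z-edges → p ∈ edges G
  in-z = ∈-++⁺ʳ hexagon ∘ ∈-++⁺ʳ x-edges ∘ ∈-++⁺ʳ y-edges

  ∈-edges⁺ : ∀ {p} → SEdge p → p ∈ edges G
  ∈-edges⁺ u₁v₁ = here refl
  ∈-edges⁺ v₁u₂ = there (here refl)
  ∈-edges⁺ u₂v₂ = there (there (here refl))
  ∈-edges⁺ v₂u₃ = there (there (there (here refl)))
  ∈-edges⁺ u₃v₃ = there (there (there (there (here refl))))
  ∈-edges⁺ v₃u₁ = there (there (there (there (there (here refl)))))
  ∈-edges⁺ (u₀-leaf m<N) with leaf m<N
  ... | x-leaf i<a = in-x (∈-biclique⁺ (here refl) i<a)
  ... | y-leaf j<b = in-y (∈-biclique⁺ (here refl) j<b)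
  ... | z-leaf k<c = in-z (∈-biclique⁺ (here refl) k<c)
  ∈-edges⁺ (x-u₁ i<a) = in-x (∈-biclique⁺ (there (here refl)) i<a)
  ∈-edges⁺ (y-u₂ j<b) = in-y (∈-biclique⁺ (there (here refl)) j<b)
  ∈-edges⁺ (z-u₃ k<c) = in-z (∈-biclique⁺ (there (here refl)) k<c)

  edges-unique : Unique (edges G)
  edges-unique =
    ++-unique-separated 7 (from-yes (unique? hexagon))
      (bicliques-unique 7 a b c (from-yes (Uniqueℕ.unique? (0 ∷ 1 ∷ [])))
                                (from-yes (Uniqueℕ.unique? (0 ∷ 2 ∷ [])))
                                (from-yes (Uniqueℕ.unique? (0 ∷ 3 ∷ []))))
      (from-yes (all? (λ p → proj₂ p <? 7) hexagon)) (bicliques-above _ _ _ 7 a b c)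

  hub : ℕ → ℕ
  hub m = ifLt m a 1 (ifLt m (a + b) 2 3)

  hub-x : ∀ {i} → i < a → hub i ≡ 1
  hub-x = ifLt-<

  hub-y : ∀ {j} → j < b → hub (a + j) ≡ 2
  hub-y {j} j<b = trans (ifLt-≥ (m≤m+n a j)) (ifLt-< (+-monoʳ-< a j<b))

  hub-z : ∀ {k} → hub (a + b + k) ≡ 3
  hub-z {k} = trans (ifLt-≥ (≤-trans (m≤m+n a b) (m≤m+n (a + b) k))) (ifLt-≥ (m≤m+n (a + b) k))

  colour : ℕ × ℕ → ℕ
  colour (1 , 4) = 2 + a
  colour (4 , 2) = 1 + a
  colour (2 , 5) = 2 + (a + b)
  colour (5 , 3) = 1 + (a + b)
  colour (3 , 6) = 2 + N
  colour (6 , 1) = 1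
  colour (0 , w) = w ∸ 6
  colour (_ , w) = w ∸ 5

  palette : ℕ → Arc (2 + N)
  palette 0 = inside 1 N
  palette 1 = inside 1 (2 + a)
  palette 2 = inside (1 + a) (2 + (a + b))
  palette 3 = inside (1 + (a + b)) (2 + N)
  palette 4 = inside (1 + a) (2 + a)
  palette 5 = inside (1 + (a + b)) (2 + (a + b))
  palette 6 = outside 2 (1 + N) (s≤s z≤n) (n≤1+n _)
  palette (suc (suc (suc (suc (suc (suc (suc m))))))) = inside (1 + m) (2 + m)

  edgeAt : ℕ → ℕ → ℕ × ℕ
  edgeAt 0 x = (0 , 6 + x)
  edgeAt 1 x = ifEq x 1 (6 , 1) (ifEq x (2 + a) (1 , 4) (1 , 5 + x))
  edgeAt 2 x = ifEq x (1 + a) (4 , 2) (ifEq x (2 + (a + b)) (2 , 5) (2 , 5 + x))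
  edgeAt 3 x = ifEq x (1 + (a + b)) (5 , 3) (ifEq x (2 + N) (3 , 6) (3 , 5 + x))
  edgeAt 4 x = ifEq x (1 + a) (4 , 2) (1 , 4)
  edgeAt 5 x = ifEq x (1 + (a + b)) (5 , 3) (2 , 5)
  edgeAt 6 x = ifEq x 1 (6 , 1) (3 , 6)
  edgeAt (suc (suc (suc (suc (suc (suc (suc m))))))) x = ifEq x (1 + m) (0 , 7 + m) (hub m , 7 + m)

  edgeAt-leaf-hub : ∀ {m h} → hub m ≡ h → edgeAt (7 + m) (2 + m) ≡ (h , 7 + m)
  edgeAt-leaf-hub {m} hub≡h = trans (ifEq-≢ (1+n≢n {1 + m})) (cong (_, 7 + m) hub≡h)

  leg-colour-bounded : ∀ {m} → m < N → 2 + m ≤ 2 + N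
  leg-colour-bounded m<N = s≤s (m≤n⇒m≤1+n m<N)

  colour-bounded : ∀ {p} → SEdge p → 1 ≤ colour p × colour p ≤ 2 + N
  colour-bounded u₁v₁ = s≤s z≤n , s≤s (s≤s a≤N)
  colour-bounded v₁u₂ = s≤s z≤n , s≤s (m≤n⇒m≤1+n a≤N)
  colour-bounded u₂v₂ = s≤s z≤n , s≤s (s≤s a+b≤N)
  colour-bounded v₂u₃ = s≤s z≤n , s≤s (m≤n⇒m≤1+n a+b≤N)
  colour-bounded u₃v₃ = s≤s z≤n , ≤-refl
  colour-bounded v₃u₁ = s≤s z≤n , s≤s z≤n
  colour-bounded (u₀-leaf m<N) = s≤s z≤n , m≤n⇒m≤1+n (m≤n⇒m≤1+n m<N)
  colour-bounded (x-u₁ i<a) = s≤s z≤n , leg-colour-bounded (x<N i<a)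
  colour-bounded (y-u₂ j<b) = s≤s z≤n , leg-colour-bounded (y<N j<b)
  colour-bounded (z-u₃ k<c) = s≤s z≤n , leg-colour-bounded (z<N k<c)

  decodes : ∀ {v p} → SEdge p → IsEndpoint v p → Decodes G colour palette edgeAt v p
  decodes u₁v₁ (inj₁ refl) = (s≤s z≤n , ≤-refl) , ifEq-≡ (2 + a)
  decodes u₁v₁ (inj₂ refl) = (n≤1+n _ , ≤-refl) , ifEq-≢ (1+n≢n {1 + a})
  decodes v₁u₂ (inj₁ refl) = (≤-refl , n≤1+n _) , ifEq-≡ (1 + a)
  decodes v₁u₂ (inj₂ refl) = (≤-refl , s≤s (m≤n⇒m≤1+n (m≤m+n a b))) , ifEq-≡ (1 + a)
  decodes u₂v₂ (inj₁ refl) =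
    (s≤s (m≤n⇒m≤1+n (m≤m+n a b)) , ≤-refl) , trans (ifEq-≢ (>⇒≢ (s≤s (s≤s (m≤m+n a b))))) (ifEq-≡ (2 + (a + b)))
  decodes u₂v₂ (inj₂ refl) = (n≤1+n _ , ≤-refl) , ifEq-≢ (1+n≢n {1 + (a + b)})
  decodes v₂u₃ (inj₁ refl) = (≤-refl , n≤1+n _) , ifEq-≡ (1 + (a + b))
  decodes v₂u₃ (inj₂ refl) = (≤-refl , s≤s (m≤n⇒m≤1+n a+b≤N)) , ifEq-≡ (1 + (a + b))
  decodes u₃v₃ (inj₁ refl) =
    (s≤s (m≤n⇒m≤1+n a+b≤N) , ≤-refl) , trans (ifEq-≢ (>⇒≢ (s≤s (s≤s a+b≤N)))) (ifEq-≡ (2 + N))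
  decodes u₃v₃ (inj₂ refl) = inj₂ (≤-refl , ≤-refl) , refl
  decodes v₃u₁ (inj₁ refl) = inj₁ (≤-refl , ≤-refl) , refl
  decodes v₃u₁ (inj₂ refl) = (≤-refl , s≤s z≤n) , refl
  decodes (u₀-leaf m<N) (inj₁ refl) = (s≤s z≤n , m<N) , refl
  decodes (u₀-leaf {m} m<N) (inj₂ refl) = (≤-refl , n≤1+n _) , ifEq-≡ (1 + m)
  decodes (x-u₁ i<a) (inj₁ refl) = (s≤s z≤n , s≤s (s≤s (<⇒≤ i<a))) , ifEq-≢ (<⇒≢ (s≤s (s≤s i<a)))
  decodes (x-u₁ i<a) (inj₂ refl) = (n≤1+n _ , ≤-refl) , edgeAt-leaf-hub (hub-x i<a)
  decodes (y-u₂ {j} j<b) (inj₁ refl) =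
      (s≤s (m≤n⇒m≤1+n (m≤m+n a j)) , s≤s (s≤s (+-monoʳ-≤ a (<⇒≤ j<b))))
    , trans (ifEq-≢ (>⇒≢ (s≤s (s≤s (m≤m+n a j))))) (ifEq-≢ (<⇒≢ (s≤s (s≤s (+-monoʳ-< a j<b)))))
  decodes (y-u₂ j<b) (inj₂ refl) = (n≤1+n _ , ≤-refl) , edgeAt-leaf-hub (hub-y j<b)
  decodes (z-u₃ {k} k<c) (inj₁ refl) =
      (s≤s (m≤n⇒m≤1+n (m≤m+n (a + b) k)) , s≤s (s≤s (+-monoʳ-≤ (a + b) (<⇒≤ k<c))))
    , trans (ifEq-≢ (>⇒≢ (s≤s (s≤s (m≤m+n (a + b) k))))) (ifEq-≢ (<⇒≢ (s≤s (s≤s (z<N k<c)))))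
  decodes (z-u₃ k<c) (inj₂ refl) = (n≤1+n _ , ≤-refl) , edgeAt-leaf-hub hub-z

  realised : ∀ {v x p} → edgeAt v x ≡ p → SEdge p → IsEndpoint v p → colour p ≡ x →
             Realises G colour palette edgeAt v x
  realised refl e v∈e colour≡x = ∈-edges⁺ e , v∈e , colour≡x

  leg-realised : ∀ {m} → m < N → Realises G colour palette edgeAt (7 + m) (2 + m)
  leg-realised m<N with leaf m<N
  ... | x-leaf i<a = realised (edgeAt-leaf-hub (hub-x i<a)) (x-u₁ i<a) (inj₂ refl) refl
  ... | y-leaf j<b = realised (edgeAt-leaf-hub (hub-y j<b)) (y-u₂ j<b) (inj₂ refl) refl
  ... | z-leaf k<c = realised (edgeAt-leaf-hub hub-z) (z-u₃ k<c) (inj₂ refl) refl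

  realises : ∀ {v x} → v < n G → x ∈ᵃ palette v → Realises G colour palette edgeAt v x
  realises {0} _ (s≤s z≤n , m<N) = realised refl (u₀-leaf m<N) (inj₁ refl) refl
  realises {1} _ (lo≤x , x≤hi) with interval-view lo≤x x≤hi
  ... | lower = realised refl v₃u₁ (inj₂ refl) refl
  ... | upper = realised (ifEq-≡ (2 + a)) u₁v₁ (inj₁ refl) refl
  ... | inner i lt = realised (ifEq-≢ (<⇒≢ lt)) (x-u₁ (+-cancelˡ-< 2 i a lt)) (inj₁ refl) refl
  realises {2} _ (lo≤x , x≤hi) with interval-view lo≤x x≤hi
  ... | lower = realised (ifEq-≡ (1 + a)) v₁u₂ (inj₂ refl) refl
  ... | upper = realised (trans (ifEq-≢ (>⇒≢ (s≤s (s≤s (m≤m+n a b))))) (ifEq-≡ (2 + (a + b)))) u₂v₂ (inj₁ refl) refl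
  ... | inner j lt =
    realised (trans (ifEq-≢ (>⇒≢ (s≤s (s≤s (m≤m+n a j))))) (ifEq-≢ (<⇒≢ lt)))
             (y-u₂ (+-cancelˡ-< (2 + a) j b lt)) (inj₁ refl) refl
  realises {3} _ (lo≤x , x≤hi) with interval-view lo≤x x≤hi
  ... | lower = realised (ifEq-≡ (1 + (a + b))) v₂u₃ (inj₂ refl) refl
  ... | upper = realised (trans (ifEq-≢ (>⇒≢ (s≤s (s≤s a+b≤N)))) (ifEq-≡ (2 + N))) u₃v₃ (inj₁ refl) refl
  ... | inner k lt =
    realised (trans (ifEq-≢ (>⇒≢ (s≤s (s≤s (m≤m+n (a + b) k))))) (ifEq-≢ (<⇒≢ lt)))
             (z-u₃ (+-cancelˡ-< (2 + (a + b)) k c lt)) (inj₁ refl) refl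
  realises {4} _ (lo≤x , x≤hi) with interval-view lo≤x x≤hi
  ... | lower = realised (ifEq-≡ (1 + a)) v₁u₂ (inj₁ refl) refl
  ... | upper = realised (ifEq-≢ (1+n≢n {1 + a})) u₁v₁ (inj₂ refl) refl
  ... | inner k lt = contradiction lt (m+n≮m (2 + a) k)
  realises {5} _ (lo≤x , x≤hi) with interval-view lo≤x x≤hi
  ... | lower = realised (ifEq-≡ (1 + (a + b))) v₂u₃ (inj₁ refl) refl
  ... | upper = realised (ifEq-≢ (1+n≢n {1 + (a + b)})) u₂v₂ (inj₂ refl) refl
  ... | inner k lt = contradiction lt (m+n≮m (2 + (a + b)) k)
  realises {6} _ (inj₁ (s≤s z≤n , s≤s (s≤s z≤n))) = realised refl v₃u₁ (inj₁ refl) refl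
  realises {6} _ (inj₂ (1+N<x , x≤2+N)) with ≤-antisym x≤2+N 1+N<x
  ... | refl = realised refl u₃v₃ (inj₂ refl) refl
  realises {suc (suc (suc (suc (suc (suc (suc m))))))} (s≤s (s≤s (s≤s (s≤s (s≤s (s≤s (s≤s m<N)))))))
           (lo≤x , x≤hi) with interval-view lo≤x x≤hi
  ... | lower = realised (ifEq-≡ (1 + m)) (u₀-leaf m<N) (inj₂ refl) refl
  ... | inner k lt = contradiction lt (m+n≮m (2 + m) k)
  ... | upper = leg-realised m<N

  certificate : Certificate G (2 + N)
  certificate = record
    { colour         = colour
    ; palette        = palette
    ; edgeAt         = edgeAt
    ; edges-unique   = edges-unique
    ; colour-bounded = colour-bounded ∘ ∈-edges⁻
    ; decodes        = decodes ∘ ∈-edges⁻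
    ; realises       = realises
    }

module M-certificate (a b c : ℕ) where
  open Leaves a b c

  G : Graph
  G = M-graph a b c

  data MEdge : ℕ × ℕ → Set where
    u₀-leaf : ∀ {m} → m < N → MEdge (0 , 4 + m)
    x-u₁ : ∀ {i} → i < a → MEdge (1 , 4 + i)
    x-u₂ : ∀ {i} → i < a → MEdge (2 , 4 + i)
    y-u₂ : ∀ {j} → j < b → MEdge (2 , 4 + (a + j))
    y-u₃ : ∀ {j} → j < b → MEdge (3 , 4 + (a + j))
    z-u₃ : ∀ {k} → k < c → MEdge (3 , 4 + (a + b + k))
    z-u₁ : ∀ {k} → k < c → MEdge (1 , 4 + (a + b + k))

  x-edges y-edges z-edges : List (ℕ × ℕ)
  x-edges = biclique (0 ∷ 1 ∷ 2 ∷ []) 4 a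
  y-edges = biclique (0 ∷ 2 ∷ 3 ∷ []) (4 + a) b
  z-edges = biclique (0 ∷ 3 ∷ 1 ∷ []) (4 + a + b) c

  ∈-edges⁻ : ∀ {p} → p ∈ edges G → MEdge p
  ∈-edges⁻ p∈edges with ∈-++⁻ x-edges p∈edges
  ... | inj₁ p∈x with ∈-biclique⁻ (0 ∷ 1 ∷ 2 ∷ []) 4 a p∈x
  ...   | _ , _ , here refl                 , i<a , refl = u₀-leaf (x<N i<a)
  ...   | _ , _ , there (here refl)         , i<a , refl = x-u₁ i<a
  ...   | _ , _ , there (there (here refl)) , i<a , refl = x-u₂ i<a
  ∈-edges⁻ _ | inj₂ p∈yz with ∈-++⁻ y-edges p∈yz
  ... | inj₁ p∈y with ∈-biclique⁻ (0 ∷ 2 ∷ 3 ∷ []) (4 + a) b p∈y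
  ...   | _ , _ , here refl                 , j<b , refl = u₀-leaf (y<N j<b)
  ...   | _ , _ , there (here refl)         , j<b , refl = y-u₂ j<b
  ...   | _ , _ , there (there (here refl)) , j<b , refl = y-u₃ j<b
  ∈-edges⁻ _ | inj₂ _ | inj₂ p∈z with ∈-biclique⁻ (0 ∷ 3 ∷ 1 ∷ []) (4 + a + b) c p∈z
  ...   | _ , _ , here refl                 , k<c , refl = u₀-leaf (z<N k<c)
  ...   | _ , _ , there (here refl)         , k<c , refl = z-u₃ k<c
  ...   | _ , _ , there (there (here refl)) , k<c , refl = z-u₁ k<c

  in-x : ∀ {p} → p ∈ x-edges → p ∈ edges G
  in-x = ∈-++⁺ˡ
  in-y : ∀ {p} → p ∈ y-edges → p ∈ edges G
  in-y = ∈-++⁺ʳ x-edges ∘ ∈-++⁺ˡ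
  in-z : ∀ {p} → p ∈ z-edges → p ∈ edges G
  in-z = ∈-++⁺ʳ x-edges ∘ ∈-++⁺ʳ y-edges

  ∈-edges⁺ : ∀ {p} → MEdge p → p ∈ edges G
  ∈-edges⁺ (u₀-leaf m<N) with leaf m<N
  ... | x-leaf i<a = in-x (∈-biclique⁺ (here refl) i<a)
  ... | y-leaf j<b = in-y (∈-biclique⁺ (here refl) j<b)
  ... | z-leaf k<c = in-z (∈-biclique⁺ (here refl) k<c)
  ∈-edges⁺ (x-u₁ i<a) = in-x (∈-biclique⁺ (there (here refl)) i<a)
  ∈-edges⁺ (x-u₂ i<a) = in-x (∈-biclique⁺ (there (there (here refl))) i<a)
  ∈-edges⁺ (y-u₂ j<b) = in-y (∈-biclique⁺ (there (here refl)) j<b)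
  ∈-edges⁺ (y-u₃ j<b) = in-y (∈-biclique⁺ (there (there (here refl))) j<b)
  ∈-edges⁺ (z-u₃ k<c) = in-z (∈-biclique⁺ (there (here refl)) k<c)
  ∈-edges⁺ (z-u₁ k<c) = in-z (∈-biclique⁺ (there (there (here refl))) k<c)

  edges-unique : Unique (edges G)
  edges-unique = bicliques-unique 4 a b c (from-yes (Uniqueℕ.unique? (0 ∷ 1 ∷ 2 ∷ [])))
                                          (from-yes (Uniqueℕ.unique? (0 ∷ 2 ∷ 3 ∷ [])))
                                          (from-yes (Uniqueℕ.unique? (0 ∷ 3 ∷ 1 ∷ [])))

  -- Leaf m sees m+2 towards u₀, m+1 towards `low m` and m+3 towards `high m`.
  low high : ℕ → ℕ
  low m = ifLt m a 1 3
  high m = ifLt m (a + b) 2 1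

  low-x : ∀ {i} → i < a → low i ≡ 1
  low-x = ifLt-<

  low-y : ∀ {j} → low (a + j) ≡ 3
  low-y {j} = ifLt-≥ (m≤m+n a j)

  low-z : ∀ {k} → low (a + b + k) ≡ 3
  low-z {k} = ifLt-≥ (≤-trans (m≤m+n a b) (m≤m+n (a + b) k))

  high-x : ∀ {i} → i < a → high i ≡ 2
  high-x i<a = ifLt-< (≤-trans i<a (m≤m+n a b))

  high-y : ∀ {j} → j < b → high (a + j) ≡ 2
  high-y j<b = ifLt-< (+-monoʳ-< a j<b)

  high-z : ∀ {k} → high (a + b + k) ≡ 1
  high-z {k} = ifLt-≥ (m≤m+n (a + b) k)

  colour : ℕ × ℕ → ℕ
  colour (0 , suc (suc (suc (suc m)))) = 2 + m
  colour (1 , suc (suc (suc (suc m)))) = ifLt m a (1 + m) (3 + m)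
  colour (2 , suc (suc (suc (suc m)))) = 3 + m
  colour (3 , suc (suc (suc (suc m)))) = 1 + m
  colour _ = 0

  colour-x-u₁ : ∀ {i} → i < a → colour (1 , 4 + i) ≡ 1 + i
  colour-x-u₁ = ifLt-<

  colour-z-u₁ : ∀ {k} → colour (1 , 4 + (a + b + k)) ≡ 3 + (a + b + k)
  colour-z-u₁ {k} = ifLt-≥ (≤-trans (m≤m+n a b) (m≤m+n (a + b) k))

  palette : ℕ → Arc (2 + N)
  palette 0 = inside 2 (1 + N)
  palette 1 = outside (1 + a) (2 + (a + b)) (s≤s z≤n) (s≤s (s≤s a+b≤N))
  palette 2 = inside 3 (2 + (a + b))
  palette 3 = inside (1 + a) N
  palette (suc (suc (suc (suc m)))) = inside (1 + m) (3 + m)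

  edgeAt : ℕ → ℕ → ℕ × ℕ
  edgeAt 0 x = (0 , 2 + x)
  edgeAt 1 x = ifLt a x (1 , 1 + x) (1 , 3 + x)
  edgeAt 2 x = (2 , 1 + x)
  edgeAt 3 x = (3 , 3 + x)
  edgeAt (suc (suc (suc (suc m)))) x =
    ifEq x (2 + m) (0 , 4 + m) (ifEq x (1 + m) (low m , 4 + m) (high m , 4 + m))

  edgeAt-leaf-low : ∀ {m h} → low m ≡ h → edgeAt (4 + m) (1 + m) ≡ (h , 4 + m)
  edgeAt-leaf-low {m} low≡h = trans (ifEq-≢ (<⇒≢ (n<1+n (1 + m)))) (trans (ifEq-≡ (1 + m)) (cong (_, 4 + m) low≡h))

  edgeAt-leaf-high : ∀ {m h} → high m ≡ h → edgeAt (4 + m) (3 + m) ≡ (h , 4 + m)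
  edgeAt-leaf-high {m} high≡h =
    trans (ifEq-≢ (1+n≢n {2 + m})) (trans (ifEq-≢ (>⇒≢ (n≤1+n (2 + m)))) (cong (_, 4 + m) high≡h))

  a<3+a+b+k : ∀ {k} → a < 3 + (a + b + k)
  a<3+a+b+k {k} = s≤s (≤-trans (≤-trans (m≤m+n a b) (m≤m+n (a + b) k)) (m≤n+m _ 2))

  Bounded : ℕ → Set
  Bounded x = 1 ≤ x × x ≤ 2 + N

  colour-bounded : ∀ {p} → MEdge p → Bounded (colour p)
  colour-bounded (u₀-leaf m<N) = s≤s z≤n , s≤s (s≤s (<⇒≤ m<N))
  colour-bounded (x-u₁ i<a) = subst Bounded (sym (colour-x-u₁ i<a)) (s≤s z≤n , m≤n⇒m≤1+n (m≤n⇒m≤1+n (x<N i<a)))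
  colour-bounded (x-u₂ i<a) = s≤s z≤n , s≤s (s≤s (x<N i<a))
  colour-bounded (y-u₂ j<b) = s≤s z≤n , s≤s (s≤s (y<N j<b))
  colour-bounded (y-u₃ j<b) = s≤s z≤n , m≤n⇒m≤1+n (m≤n⇒m≤1+n (y<N j<b))
  colour-bounded (z-u₃ k<c) = s≤s z≤n , m≤n⇒m≤1+n (m≤n⇒m≤1+n (z<N k<c))
  colour-bounded (z-u₁ k<c) = subst Bounded (sym colour-z-u₁) (s≤s z≤n , s≤s (s≤s (z<N k<c)))

  decoded : ∀ v {p x} → x ∈ᵃ palette v → edgeAt v x ≡ p → colour p ≡ x → Decodes G colour palette edgeAt v p
  decoded _ x∈palette edgeAt≡p refl = x∈palette , edgeAt≡p

  decodes : ∀ {v p} → MEdge p → IsEndpoint v p → Decodes G colour palette edgeAt v p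
  decodes (u₀-leaf m<N) (inj₁ refl) = (s≤s (s≤s z≤n) , s≤s m<N) , refl
  decodes (u₀-leaf {m} m<N) (inj₂ refl) = (n≤1+n _ , n≤1+n _) , ifEq-≡ (2 + m)
  decodes (x-u₁ i<a) (inj₁ refl) = decoded 1 (inj₁ (s≤s z≤n , s≤s i<a)) (ifLt-≥ i<a) (colour-x-u₁ i<a)
  decodes (x-u₁ i<a) (inj₂ refl) =
    decoded (4 + _) (≤-refl , m≤n+m _ 2) (edgeAt-leaf-low (low-x i<a)) (colour-x-u₁ i<a)
  decodes (x-u₂ i<a) (inj₁ refl) = (s≤s (s≤s (s≤s z≤n)) , s≤s (s≤s (≤-trans i<a (m≤m+n a b)))) , refl
  decodes (x-u₂ i<a) (inj₂ refl) = (m≤n+m _ 2 , ≤-refl) , edgeAt-leaf-high (high-x i<a)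
  decodes (y-u₂ j<b) (inj₁ refl) = (s≤s (s≤s (s≤s z≤n)) , s≤s (s≤s (+-monoʳ-< a j<b))) , refl
  decodes (y-u₂ j<b) (inj₂ refl) = (m≤n+m _ 2 , ≤-refl) , edgeAt-leaf-high (high-y j<b)
  decodes (y-u₃ {j} j<b) (inj₁ refl) = (s≤s (m≤m+n a j) , y<N j<b) , refl
  decodes (y-u₃ j<b) (inj₂ refl) = (≤-refl , m≤n+m _ 2) , edgeAt-leaf-low low-y
  decodes (z-u₃ {k} k<c) (inj₁ refl) = (s≤s (≤-trans (m≤m+n a b) (m≤m+n (a + b) k)) , z<N k<c) , refl
  decodes (z-u₃ k<c) (inj₂ refl) = (≤-refl , m≤n+m _ 2) , edgeAt-leaf-low low-z
  decodes (z-u₁ {k} k<c) (inj₁ refl) =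
    decoded 1 (inj₂ (s≤s (s≤s (s≤s (m≤m+n (a + b) k))) , s≤s (s≤s (z<N k<c)))) (ifLt-< a<3+a+b+k) colour-z-u₁
  decodes (z-u₁ k<c) (inj₂ refl) = decoded (4 + _) (m≤n+m _ 2 , ≤-refl) (edgeAt-leaf-high high-z) colour-z-u₁

  realised : ∀ {v x p} → edgeAt v x ≡ p → MEdge p → IsEndpoint v p → colour p ≡ x →
             Realises G colour palette edgeAt v x
  realised refl e v∈e colour≡x = ∈-edges⁺ e , v∈e , colour≡x

  low-leg-realised : ∀ {m} → m < N → Realises G colour palette edgeAt (4 + m) (1 + m)
  low-leg-realised m<N with leaf m<N
  ... | x-leaf i<a = realised (edgeAt-leaf-low (low-x i<a)) (x-u₁ i<a) (inj₂ refl) (colour-x-u₁ i<a)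
  ... | y-leaf j<b = realised (edgeAt-leaf-low low-y) (y-u₃ j<b) (inj₂ refl) refl
  ... | z-leaf k<c = realised (edgeAt-leaf-low low-z) (z-u₃ k<c) (inj₂ refl) refl

  high-leg-realised : ∀ {m} → m < N → Realises G colour palette edgeAt (4 + m) (3 + m)
  high-leg-realised m<N with leaf m<N
  ... | x-leaf i<a = realised (edgeAt-leaf-high (high-x i<a)) (x-u₂ i<a) (inj₂ refl) refl
  ... | y-leaf j<b = realised (edgeAt-leaf-high (high-y j<b)) (y-u₂ j<b) (inj₂ refl) refl
  ... | z-leaf k<c = realised (edgeAt-leaf-high high-z) (z-u₁ k<c) (inj₂ refl) colour-z-u₁

  realises : ∀ {v x} → v < n G → x ∈ᵃ palette v → Realises G colour palette edgeAt v x
  realises {0} _ (s≤s (s≤s z≤n) , s≤s m<N) = realised refl (u₀-leaf m<N) (inj₁ refl) refl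
  realises {1} _ (inj₁ (s≤s z≤n , s≤s i<a)) = realised (ifLt-≥ i<a) (x-u₁ i<a) (inj₁ refl) (colour-x-u₁ i<a)
  realises {1} _ (inj₂ (2+a+b<x , x≤2+N)) with k , refl ← m≤n⇒∃[o]m+o≡n 2+a+b<x =
    realised (ifLt-< a<3+a+b+k) (z-u₁ (+-cancelˡ-< (a + b) k c (≤-pred (≤-pred x≤2+N)))) (inj₁ refl) colour-z-u₁
  realises {2} _ (s≤s (s≤s (s≤s z≤n)) , s≤s (s≤s m<a+b)) with leaf (≤-trans m<a+b a+b≤N)
  ... | x-leaf i<a = realised refl (x-u₂ i<a) (inj₁ refl) refl
  ... | y-leaf j<b = realised refl (y-u₂ j<b) (inj₁ refl) refl
  ... | z-leaf {k} _ = contradiction m<a+b (m+n≮m (a + b) k)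
  realises {3} _ (s≤s a≤m , m<N) with leaf m<N
  ... | x-leaf i<a = contradiction a≤m (<⇒≱ i<a)
  ... | y-leaf j<b = realised refl (y-u₃ j<b) (inj₁ refl) refl
  ... | z-leaf k<c = realised refl (z-u₃ k<c) (inj₁ refl) refl
  realises {suc (suc (suc (suc m)))} (s≤s (s≤s (s≤s (s≤s m<N)))) (lo≤x , x≤hi) with interval-view lo≤x x≤hi
  ... | lower = low-leg-realised m<N
  ... | upper = high-leg-realised m<N
  ... | inner (suc k) lt = contradiction (≤-pred (≤-pred (≤-pred lt))) (m+1+n≰m m)
  ... | inner zero _ rewrite +-identityʳ m = realised (ifEq-≡ (2 + m)) (u₀-leaf m<N) (inj₂ refl) refl

  certificate : Certificate G (2 + N)
  certificate = record
    { colour         = colour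
    ; palette        = palette
    ; edgeAt         = edgeAt
    ; edges-unique   = edges-unique
    ; colour-bounded = colour-bounded ∘ ∈-edges⁻
    ; decodes        = decodes ∘ ∈-edges⁻
    ; realises       = realises
    }

-- The colourings need no positivity assumption on a, b, c.
theorem4 : (a b c : ℕ) → 1 ≤ a → 1 ≤ b → 1 ≤ c →
    HasCyclicIntervalColoring (S-graph a b c) × HasCyclicIntervalColoring (M-graph a b c)
theorem4 a b c _ _ _ =
    certified⇒cyclic-interval-colourable (S-certificate.certificate a b c)
  , certified⇒cyclic-interval-colourable (M-certificate.certificate a b c)
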